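{- For $n\ge1$, the set of periodic points of $\operatorname{SC}_{321}:S_n\to S_n$ is the set of permutations in $S_n$ that avoid both $123$ and $321$ consecutively. When $n\geq 2$, these points have period $2$.
   Context: $S_n$ is the set of permutations of $[n]$ in one-line notation. A permutation avoids $123$ (resp. $321$) consecutively if it has no three consecutive entries in increasing (resp. decreasing) order. $\operatorname{SC}_{321}:S_n\to S_n$ sends a permutation through a stack: at each step, if there is a next input entry and placing it on top of the stack would make the stack contents, read top to bottom, avoid $321$ consecutively, push it; otherwise pop the top entry of the stack to the end of the output; stop when the output has length $n$. A periodic point of $f:S_n\to S_n$ is $\pi$ with $f^t(\pi)=\pi$ for some $t\ge1$; its period is the least such $t$. -}

module Defs where

open import Data.Nat using (ℕ; zero; suc; _*_; _≤_; _<_; _<ᵇ_)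
open import Data.Bool using (Bool; true; false; _∧_; _∨_)
open import Data.List using (List; []; _∷_; length; applyUpTo)
open import Data.List.Relation.Binary.Permutation.Propositional using (_↭_)
open import Data.Product using (∃; _×_)
open import Relation.Binary.PropositionalEquality using (_≡_; _≢_)

-- S n : permutations of [n] = {1,…,n} in one-line notation,
-- i.e. lists that are a rearrangement of [1, 2, …, n].
S : ℕ → List ℕ → Set
S n π = π ↭ applyUpTo suc n

has123 : List ℕ → Bool
has123 (a ∷ b ∷ c ∷ r) = ((a <ᵇ b) ∧ (b <ᵇ c)) ∨ has123 (b ∷ c ∷ r)
has123 _ = false

has321 : List ℕ → Bool
has321 (a ∷ b ∷ c ∷ r) = ((b <ᵇ a) ∧ (c <ᵇ b)) ∨ has321 (b ∷ c ∷ r)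
has321 _ = false

Avoids123 : List ℕ → Set
Avoids123 π = has123 π ≡ false

Avoids321 : List ℕ → Set
Avoids321 π = has321 π ≡ false

-- One run of the stack machine.  Arguments: fuel, remaining input,
-- stack (head = top).  Each entry is pushed once and popped once, so 2n
-- steps suffice to produce an output of length n.
sc-run : ℕ → List ℕ → List ℕ → List ℕ
sc-run zero _ _ = []
sc-run (suc f) [] [] = []
sc-run (suc f) [] (y ∷ st) = y ∷ sc-run f [] st
sc-run (suc f) (x ∷ xs) st with has321 (x ∷ st)
... | false = sc-run f xs (x ∷ st)
... | true with st
...   | [] = []
...   | y ∷ st′ = y ∷ sc-run f (x ∷ xs) st′

SC321 : List ℕ → List ℕ
SC321 π = sc-run (2 * length π) π []

iter : {A : Set} → (A → A) → ℕ → A → A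
iter f zero x = x
iter f (suc t) x = f (iter f t x)

Periodic : {A : Set} → (A → A) → A → Set
Periodic f x = ∃ λ t → 1 ≤ t × iter f t x ≡ x

HasPeriod : {A : Set} → (A → A) → A → ℕ → Set
HasPeriod f x p = 1 ≤ p × iter f p x ≡ x × (∀ t → 1 ≤ t → t < p → iter f t x ≢ x)

{-# OPTIONS --safe #-}
-- SC321 has a closed form: the entries that are the middle of a consecutive 123 leave
-- the stack in their original order, and all other entries leave afterwards in reverse
-- order. Let μ count the consecutive 123s and 321s. Each middle contributes at most one
-- window to μ (SC321 π), and every monotone window of the reversed remainder comes from
-- a 321 of π, so μ never increases and is constant on a periodic orbit. If it were
-- positive there, equality forces the first middle of each point to start a monotone
-- window of its image; that window cannot be a 321, since the next image would then end
-- with a 123 and μ would drop one step later. So from the second iterate on every point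
-- starts with a consecutive 123, whose middle becomes the first entry of the next point:
-- the first entry grows strictly along the orbit, which is absurd. Hence periodic points
-- avoid both patterns, and on them SC321 is reversal, an involution without fixed points
-- on permutations of length at least 2.
module Submission where

open import Defs
open import Data.Bool using (Bool; true; false; _∧_; _∨_; if_then_else_; T)
open import Data.Bool.Properties using (∧-comm; ∨-comm; ∨-identityʳ; ∨-conicalˡ; ∨-conicalʳ; ∧-zeroʳ)
open import Data.Empty using (⊥; ⊥-elim)
open import Data.List using (List; []; _∷_; length; _++_; _∷ʳ_; reverse; initLast; _∷ʳ′_)
open import Data.List.Properties
  using (++-assoc; ++-identityʳ; unfold-reverse; reverse-++; reverse-involutive; length-++; length-applyUpTo; ∷-injectiveˡ)
open import Data.List.Relation.Unary.All.Properties using (∷ʳ⁻)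
open import Data.List.Relation.Unary.AllPairs using (_∷_)
open import Data.List.Relation.Unary.Unique.Propositional using (Unique)
open import Data.List.Relation.Unary.Unique.Propositional.Properties using (applyUpTo⁺₁)
open import Data.List.Relation.Binary.Permutation.Propositional using (↭⇒↭ₛ; ↭-sym)
open import Data.List.Relation.Binary.Permutation.Propositional.Properties using (↭-length)
open import Data.Nat using (ℕ; zero; suc; _+_; _*_; _≤_; _<_; _<ᵇ_; z≤n; s≤s)
open import Data.Nat.Properties
open import Algebra.Properties.CommutativeSemigroup +-commutativeSemigroup using (interchange)
open import Data.Product using (_×_; _,_; proj₁; proj₂; ∃-syntax)
open import Data.Sum using (_⊎_; inj₁; inj₂)
open import Data.Unit using (tt; ⊤)
open import Function.Base using (_∘_)
open import Function.Bundles using (_⇔_; mk⇔; Equivalence)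
open import Relation.Nullary using (¬_; contradiction)
open import Relation.Binary.PropositionalEquality
open import Data.List.Relation.Binary.Permutation.Setoid.Properties (setoid ℕ) using (Unique-resp-↭)

<ᵇ-true⇒< : ∀ m n → (m <ᵇ n) ≡ true → m < n
<ᵇ-true⇒< m n e = <ᵇ⇒< m n (subst T (sym e) tt)

<⇒<ᵇ-true : ∀ {m n} → m < n → (m <ᵇ n) ≡ true
<⇒<ᵇ-true {m} {n} m<n with m <ᵇ n | <⇒<ᵇ m<n
... | true | _ = refl

<⇒>ᵇ-false : ∀ {m n} → m < n → (n <ᵇ m) ≡ false
<⇒>ᵇ-false {m} {n} m<n with n <ᵇ m in e
... | false = refl
... | true = ⊥-elim (<-asym m<n (<ᵇ-true⇒< n m e))

Pattern : Set
Pattern = ℕ → ℕ → ℕ → Bool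

rises falls monotone : Pattern
rises a b c = (a <ᵇ b) ∧ (b <ᵇ c)
falls a b c = (b <ᵇ a) ∧ (c <ᵇ b)
monotone a b c = rises a b c ∨ falls a b c

rises⇒< : ∀ a b c → rises a b c ≡ true → a < b × b < c
rises⇒< a b c _ with a <ᵇ b in ab | b <ᵇ c in bc
... | true | true = <ᵇ-true⇒< a b ab , <ᵇ-true⇒< b c bc
rises⇒< a b c () | true | false
rises⇒< a b c () | false | _

falls⇒> : ∀ a b c → falls a b c ≡ true → b < a × c < b
falls⇒> a b c _ with b <ᵇ a in ba | c <ᵇ b in cb
... | true | true = <ᵇ-true⇒< b a ba , <ᵇ-true⇒< c b cb
falls⇒> a b c () | true | false
falls⇒> a b c () | false | _

<<⇒rises : ∀ {a b c} → a < b → b < c → rises a b c ≡ true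
<<⇒rises a<b b<c rewrite <⇒<ᵇ-true a<b | <⇒<ᵇ-true b<c = refl

>>⇒falls : ∀ {a b c} → b < a → c < b → falls a b c ≡ true
>>⇒falls b<a c<b rewrite <⇒<ᵇ-true b<a | <⇒<ᵇ-true c<b = refl

¬rises⇒≤ : ∀ {a b c} → a < b → rises a b c ≡ false → c ≤ b
¬rises⇒≤ a<b ¬r = ≮⇒≥ λ b<c → contradiction (trans (sym (<<⇒rises a<b b<c)) ¬r) λ ()

rises-or-falls : ∀ a b c → monotone a b c ≡ true → rises a b c ≡ true ⊎ falls a b c ≡ true
rises-or-falls a b c mono with rises a b c
... | true = inj₁ refl
... | false = inj₂ mono

rises˘≡falls : ∀ a b c → rises c b a ≡ falls a b c
rises˘≡falls a b c = ∧-comm (c <ᵇ b) (b <ᵇ a)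

peak-not-monotone : ∀ {b c v} → b < c → v < c → monotone b c v ≡ false
peak-not-monotone b<c v<c rewrite <⇒<ᵇ-true b<c | <⇒>ᵇ-false v<c | <⇒>ᵇ-false b<c = refl

boolToℕ : Bool → ℕ
boolToℕ true = 1
boolToℕ false = 0

boolToℕ≡0⇒false : ∀ x → boolToℕ x ≡ 0 → x ≡ false
boolToℕ≡0⇒false false _ = refl

boolToℕ≤1 : ∀ x → boolToℕ x ≤ 1
boolToℕ≤1 true = s≤s z≤n
boolToℕ≤1 false = z≤n

startsWith : Pattern → List ℕ → Bool
startsWith P (a ∷ b ∷ c ∷ _) = P a b c
startsWith P _ = false

descent-not-middle : ∀ {a b} l → b < a → startsWith rises (a ∷ b ∷ l) ≡ false
descent-not-middle [] _ = refl
descent-not-middle (_ ∷ _) b<a rewrite <⇒>ᵇ-false b<a = refl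

rising-start⇒< : ∀ a b l → startsWith rises (a ∷ b ∷ l) ≡ true → a < b
rising-start⇒< a b (c ∷ _) up = proj₁ (rises⇒< a b c up)

occurs : Pattern → List ℕ → Bool
occurs P (a ∷ b ∷ c ∷ l) = P a b c ∨ occurs P (b ∷ c ∷ l)
occurs P _ = false

count : Pattern → List ℕ → ℕ
count P [] = 0
count P (a ∷ l) = boolToℕ (startsWith P (a ∷ l)) + count P l

#rises #falls #monotone : List ℕ → ℕ
#rises = count rises
#falls = count falls
#monotone = count monotone

has123≡occurs-rises : ∀ l → has123 l ≡ occurs rises l
has123≡occurs-rises (a ∷ b ∷ c ∷ l) = cong (rises a b c ∨_) (has123≡occurs-rises (b ∷ c ∷ l))
has123≡occurs-rises (_ ∷ _ ∷ []) = refl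
has123≡occurs-rises (_ ∷ []) = refl
has123≡occurs-rises [] = refl

has321≡occurs-falls : ∀ l → has321 l ≡ occurs falls l
has321≡occurs-falls (a ∷ b ∷ c ∷ l) = cong (falls a b c ∨_) (has321≡occurs-falls (b ∷ c ∷ l))
has321≡occurs-falls (_ ∷ _ ∷ []) = refl
has321≡occurs-falls (_ ∷ []) = refl
has321≡occurs-falls [] = refl

count-∷≡0 : ∀ P a l → count P (a ∷ l) ≡ 0 → startsWith P (a ∷ l) ≡ false × count P l ≡ 0
count-∷≡0 P a l none = boolToℕ≡0⇒false _ (m+n≡0⇒m≡0 _ none) , m+n≡0⇒n≡0 _ none

count≡0⇒¬occurs : ∀ P l → count P l ≡ 0 → occurs P l ≡ false
count≡0⇒¬occurs P (a ∷ b ∷ c ∷ l) none =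
  cong₂ _∨_ (proj₁ split) (count≡0⇒¬occurs P (b ∷ c ∷ l) (proj₂ split))
  where
  split : P a b c ≡ false × count P (b ∷ c ∷ l) ≡ 0
  split = count-∷≡0 P a (b ∷ c ∷ l) none
count≡0⇒¬occurs P (_ ∷ _ ∷ []) _ = refl
count≡0⇒¬occurs P (_ ∷ []) _ = refl
count≡0⇒¬occurs P [] _ = refl

¬occurs⇒count≡0 : ∀ P l → occurs P l ≡ false → count P l ≡ 0
¬occurs⇒count≡0 P (a ∷ b ∷ c ∷ l) e =
  cong₂ _+_ (cong boolToℕ (∨-conicalˡ (P a b c) _ e))
            (¬occurs⇒count≡0 P (b ∷ c ∷ l) (∨-conicalʳ (P a b c) _ e))
¬occurs⇒count≡0 P (_ ∷ _ ∷ []) _ = refl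
¬occurs⇒count≡0 P (_ ∷ []) _ = refl
¬occurs⇒count≡0 P [] _ = refl

count≡0⇔¬occurs : ∀ P l → count P l ≡ 0 ⇔ occurs P l ≡ false
count≡0⇔¬occurs P l = mk⇔ (count≡0⇒¬occurs P l) (¬occurs⇒count≡0 P l)

#rises≡0⇔Avoids123 : ∀ l → #rises l ≡ 0 ⇔ Avoids123 l
#rises≡0⇔Avoids123 l rewrite has123≡occurs-rises l = count≡0⇔¬occurs rises l

#falls≡0⇔Avoids321 : ∀ l → #falls l ≡ 0 ⇔ Avoids321 l
#falls≡0⇔Avoids321 l rewrite has321≡occurs-falls l = count≡0⇔¬occurs falls l

startsWith⇒0<count : ∀ P l → startsWith P l ≡ true → 0 < count P l
startsWith⇒0<count P (a ∷ l) s rewrite s = s≤s z≤n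

count-++-≤ : ∀ P A C → count P (A ++ C) ≤ length A + count P C
count-++-≤ P [] C = ≤-refl
count-++-≤ P (a ∷ A) C = +-mono-≤ (boolToℕ≤1 (startsWith P (a ∷ A ++ C))) (count-++-≤ P A C)

count-++-skip : ∀ P A m C → startsWith P (m ∷ C) ≡ false → count P (A ++ m ∷ C) ≤ length A + count P C
count-++-skip P A m C skip =
  ≤-trans (count-++-≤ P A (m ∷ C)) (≤-reflexive (cong (λ x → length A + (boolToℕ x + count P C)) skip))

boolToℕ-monotone : ∀ a b c → boolToℕ (monotone a b c) ≡ boolToℕ (rises a b c) + boolToℕ (falls a b c)
boolToℕ-monotone a b c with a <ᵇ b in a<b | b <ᵇ a in b<a | b <ᵇ c | c <ᵇ b
... | true | true | _ | _ = ⊥-elim (<-asym (<ᵇ-true⇒< a b a<b) (<ᵇ-true⇒< b a b<a))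
... | true | false | true | _ = refl
... | true | false | false | _ = refl
... | false | _ | _ | _ = refl

#monotone≡#rises+#falls : ∀ l → #monotone l ≡ #rises l + #falls l
#monotone≡#rises+#falls (a ∷ b ∷ c ∷ l) = begin
  boolToℕ (monotone a b c) + #monotone (b ∷ c ∷ l)
    ≡⟨ cong₂ _+_ (boolToℕ-monotone a b c) (#monotone≡#rises+#falls (b ∷ c ∷ l)) ⟩
  (boolToℕ (rises a b c) + boolToℕ (falls a b c)) + (#rises (b ∷ c ∷ l) + #falls (b ∷ c ∷ l))
    ≡⟨ interchange (boolToℕ (rises a b c)) (boolToℕ (falls a b c)) (#rises (b ∷ c ∷ l)) (#falls (b ∷ c ∷ l)) ⟩
  (boolToℕ (rises a b c) + #rises (b ∷ c ∷ l)) + (boolToℕ (falls a b c) + #falls (b ∷ c ∷ l)) ∎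
  where open ≡-Reasoning
#monotone≡#rises+#falls (_ ∷ _ ∷ []) = refl
#monotone≡#rises+#falls (_ ∷ []) = refl
#monotone≡#rises+#falls [] = refl

closes : Pattern → List ℕ → ℕ → Bool
closes P (a ∷ b ∷ []) z = P a b z
closes P (_ ∷ l@(_ ∷ _ ∷ _)) z = closes P l z
closes P _ z = false

count-∷ʳ : ∀ P l z → count P (l ∷ʳ z) ≡ count P l + boolToℕ (closes P l z)
count-∷ʳ P [] z = refl
count-∷ʳ P (a ∷ []) z = refl
count-∷ʳ P (a ∷ b ∷ []) z = +-identityʳ _
count-∷ʳ P (a ∷ b ∷ c ∷ l) z =
  trans (cong (boolToℕ (P a b c) +_) (count-∷ʳ P (b ∷ c ∷ l) z)) (sym (+-assoc (boolToℕ (P a b c)) _ _))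

closes-++ : ∀ P R a b z → closes P (R ++ a ∷ b ∷ []) z ≡ P a b z
closes-++ P [] a b z = refl
closes-++ P (_ ∷ []) a b z = refl
closes-++ P (_ ∷ _ ∷ []) a b z = refl
closes-++ P (_ ∷ r ∷ s ∷ R) a b z = closes-++ P (r ∷ s ∷ R) a b z

reverse-∷∷ : ∀ (a b : ℕ) l → reverse (a ∷ b ∷ l) ≡ reverse l ++ b ∷ a ∷ []
reverse-∷∷ a b l = begin
  reverse (a ∷ b ∷ l)            ≡⟨ unfold-reverse a (b ∷ l) ⟩
  reverse (b ∷ l) ∷ʳ a           ≡⟨ cong (_∷ʳ a) (unfold-reverse b l) ⟩
  (reverse l ∷ʳ b) ∷ʳ a          ≡⟨ ++-assoc (reverse l) (b ∷ []) (a ∷ []) ⟩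
  reverse l ++ b ∷ a ∷ []        ∎
  where open ≡-Reasoning

count-reverse : ∀ P Q → (∀ a b c → Q a b c ≡ P c b a) → ∀ l → count Q (reverse l) ≡ count P l
count-reverse P Q Q≡P˘ (a ∷ b ∷ c ∷ l) = begin
  count Q (reverse (a ∷ b ∷ c ∷ l))
    ≡⟨ cong (count Q) (unfold-reverse a (b ∷ c ∷ l)) ⟩
  count Q (reverse (b ∷ c ∷ l) ∷ʳ a)
    ≡⟨ count-∷ʳ Q (reverse (b ∷ c ∷ l)) a ⟩
  count Q (reverse (b ∷ c ∷ l)) + boolToℕ (closes Q (reverse (b ∷ c ∷ l)) a)
    ≡⟨ cong₂ (λ n l′ → n + boolToℕ (closes Q l′ a))
             (count-reverse P Q Q≡P˘ (b ∷ c ∷ l)) (reverse-∷∷ b c l) ⟩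
  count P (b ∷ c ∷ l) + boolToℕ (closes Q (reverse l ++ c ∷ b ∷ []) a)
    ≡⟨ cong (λ x → count P (b ∷ c ∷ l) + boolToℕ x) (trans (closes-++ Q (reverse l) c b a) (Q≡P˘ c b a)) ⟩
  count P (b ∷ c ∷ l) + boolToℕ (P a b c)
    ≡⟨ +-comm (count P (b ∷ c ∷ l)) _ ⟩
  count P (a ∷ b ∷ c ∷ l) ∎
  where open ≡-Reasoning
count-reverse P Q _ (_ ∷ _ ∷ []) = refl
count-reverse P Q _ (_ ∷ []) = refl
count-reverse P Q _ [] = refl

#rises-reverse : ∀ l → #rises (reverse l) ≡ #falls l
#rises-reverse = count-reverse falls rises (λ a b c → rises˘≡falls c b a)

#monotone-reverse : ∀ l → #monotone (reverse l) ≡ #monotone l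
#monotone-reverse = count-reverse monotone monotone λ a b c →
  trans (∨-comm (rises a b c) (falls a b c)) (cong₂ _∨_ (sym (rises˘≡falls a b c)) (rises˘≡falls c b a))

module _ {A : Set} (f : A → A) where

  iter-comm : ∀ k x → iter f k (f x) ≡ f (iter f k x)
  iter-comm zero x = refl
  iter-comm (suc k) x = cong f (iter-comm k x)

  iter-+ : ∀ j k x → iter f (j + k) x ≡ iter f j (iter f k x)
  iter-+ zero k x = refl
  iter-+ (suc j) k x = cong f (iter-+ j k x)

  iter-periodic : ∀ p {x} → iter f p x ≡ x → ∀ k → iter f p (iter f k x) ≡ iter f k x
  iter-periodic p cycle zero = cycle
  iter-periodic p {x} cycle (suc k) = trans (iter-comm p (iter f k x)) (cong f (iter-periodic p cycle k))

  module _ (Φ : A → ℕ) (decreasing : ∀ y → Φ (f y) ≤ Φ y) where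

    iter-decreasing : ∀ k y → Φ (iter f k y) ≤ Φ y
    iter-decreasing zero y = ≤-refl
    iter-decreasing (suc k) y = ≤-trans (decreasing (iter f k y)) (iter-decreasing k y)

    periodic⇒steady : ∀ t {x} → iter f (suc t) x ≡ x → ∀ k → Φ (f (iter f k x)) ≡ Φ (iter f k x)
    periodic⇒steady t {x} cycle k = ≤-antisym (decreasing y) (begin
      Φ y                      ≡⟨ cong Φ (iter-periodic (suc t) cycle k) ⟨
      Φ (f (iter f t y))       ≡⟨ cong Φ (iter-comm t y) ⟨
      Φ (iter f t (f y))       ≤⟨ iter-decreasing t (f y) ⟩
      Φ (f y)                  ∎)
      where
      open ≤-Reasoning
      y : A
      y = iter f k x

  steady⇒constant : (Φ : A → ℕ) → ∀ {x} → (∀ k → Φ (f (iter f k x)) ≡ Φ (iter f k x)) →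
                    ∀ k → Φ (iter f k x) ≡ Φ x
  steady⇒constant Φ steady zero = refl
  steady⇒constant Φ steady (suc k) = trans (steady k) (steady⇒constant Φ steady k)

  periodic⇒¬ascending : (g : A → ℕ) → ∀ t {x} → iter f (suc t) x ≡ x →
                        ¬ (∀ k → g (iter f k x) < g (f (iter f k x)))
  periodic⇒¬ascending g t {x} cycle ascending =
    m+1+n≰m (g x) (subst (λ y → g x + suc t ≤ g y) cycle (climb (suc t)))
    where
    climb : ∀ k → g x + k ≤ g (iter f k x)
    climb zero = ≤-reflexive (+-identityʳ (g x))
    climb (suc k) =
      subst (_≤ g (iter f (suc k) x)) (sym (+-suc (g x) k)) (≤-<-trans (climb k) (ascending k))

iter-cong : ∀ {A : Set} {f g : A → A} → (∀ x → f x ≡ g x) → ∀ k x → iter f k x ≡ iter g k x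
iter-cong f≗g zero x = refl
iter-cong {f = f} {g} f≗g (suc k) x = trans (f≗g (iter f k x)) (cong g (iter-cong f≗g k x))

middlesAfter othersAfter : ℕ → List ℕ → List ℕ
middlesAfter p [] = []
middlesAfter p (x ∷ l) = if startsWith rises (p ∷ x ∷ l) then x ∷ middlesAfter x l else middlesAfter x l
othersAfter p [] = []
othersAfter p (x ∷ l) = if startsWith rises (p ∷ x ∷ l) then othersAfter x l else x ∷ othersAfter x l

middles others : List ℕ → List ℕ
middles [] = []
middles (a ∷ l) = middlesAfter a l
others [] = []
others (a ∷ l) = a ∷ othersAfter a l

-- A middle of a consecutive 123 is popped as soon as its successor arrives; every
-- other entry stays on the stack until the input is exhausted.
SC : List ℕ → List ℕ
SC π = middles π ++ reverse (others π)

steps : List ℕ → ℕ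
steps [] = 0
steps (_ ∷ l) = suc (suc (steps l))

steps≡2*length : ∀ l → steps l ≡ 2 * length l
steps≡2*length [] = refl
steps≡2*length (_ ∷ l) = trans (cong (suc ∘ suc) (steps≡2*length l)) (sym (*-suc 2 (length l)))

sc-run-empties : ∀ f st → length st ≤ f → sc-run f [] st ≡ st
sc-run-empties zero [] _ = refl
sc-run-empties (suc f) [] _ = refl
sc-run-empties (suc f) (y ∷ st) (s≤s h) = cong (y ∷_) (sc-run-empties f st h)

sc-run-push : ∀ f x xs st → has321 (x ∷ st) ≡ false → sc-run (suc f) (x ∷ xs) st ≡ sc-run f xs (x ∷ st)
sc-run-push f x xs st free rewrite free = refl

sc-run-pop : ∀ f x xs y st → has321 (x ∷ y ∷ st) ≡ true →
             sc-run (suc f) (x ∷ xs) (y ∷ st) ≡ y ∷ sc-run f (x ∷ xs) st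
sc-run-pop f x xs y st blocked rewrite blocked = refl

has321-push : ∀ p x y z s → has321 (y ∷ z ∷ s) ≡ false → (z <ᵇ y) ≡ (p <ᵇ y) →
              has321 (x ∷ y ∷ z ∷ s) ≡ rises p y x
has321-push p x y z s h z<y≡p<y rewrite h | z<y≡p<y = trans (∨-identityʳ _) (∧-comm (y <ᵇ x) (p <ᵇ y))

has321-pop : ∀ x y z s → has321 (y ∷ z ∷ s) ≡ false → (z <ᵇ y) ≡ true → has321 (x ∷ z ∷ s) ≡ false
has321-pop x y z [] _ _ = refl
has321-pop x y z (w ∷ s) h z<y rewrite z<y with w <ᵇ z | has321 (z ∷ w ∷ s)
... | false | false = trans (∨-identityʳ _) (∧-zeroʳ (z <ᵇ x))

reverse-∷-++ : ∀ (y : ℕ) K T → reverse (y ∷ K) ++ T ≡ reverse K ++ y ∷ T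
reverse-∷-++ y K T = trans (cong (_++ T) (unfold-reverse y K)) (++-assoc (reverse K) (y ∷ []) T)

-- y is the last entry read and p its predecessor in the input. The hypothesis z < y ⇔ p < y
-- holds because either z = p, or p was popped as a middle and z < p < y.
sc-run-simulates : ∀ xs f p y z s → has321 (y ∷ z ∷ s) ≡ false → (z <ᵇ y) ≡ (p <ᵇ y) →
                   steps xs + length (y ∷ z ∷ s) ≤ f →
                   sc-run f xs (y ∷ z ∷ s) ≡ middlesAfter p (y ∷ xs) ++ reverse (othersAfter p (y ∷ xs)) ++ z ∷ s
sc-run-simulates [] f p y z s _ _ fuel = sc-run-empties f (y ∷ z ∷ s) fuel
sc-run-simulates (x ∷ xs) (suc f) p y z s free z<y≡p<y (s≤s fuel) with rises p y x in y-middle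
... | false = begin
  sc-run (suc f) (x ∷ xs) (y ∷ z ∷ s)
    ≡⟨ sc-run-push f x xs (y ∷ z ∷ s) x-free ⟩
  sc-run f xs (x ∷ y ∷ z ∷ s)
    ≡⟨ sc-run-simulates xs f y x y (z ∷ s) x-free refl (subst (_≤ f) (sym (+-suc (steps xs) _)) fuel) ⟩
  middlesAfter y (x ∷ xs) ++ reverse (othersAfter y (x ∷ xs)) ++ y ∷ z ∷ s
    ≡⟨ cong (middlesAfter y (x ∷ xs) ++_) (reverse-∷-++ y (othersAfter y (x ∷ xs)) (z ∷ s)) ⟨
  middlesAfter y (x ∷ xs) ++ reverse (y ∷ othersAfter y (x ∷ xs)) ++ z ∷ s ∎
  where
  open ≡-Reasoning
  x-free : has321 (x ∷ y ∷ z ∷ s) ≡ false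
  x-free = trans (has321-push p x y z s free z<y≡p<y) y-middle
sc-run-simulates (x ∷ xs) (suc (suc f)) p y z s free z<y≡p<y (s≤s (s≤s fuel)) | true = begin
  sc-run (suc (suc f)) (x ∷ xs) (y ∷ z ∷ s)
    ≡⟨ sc-run-pop (suc f) x xs y (z ∷ s) (trans (has321-push p x y z s free z<y≡p<y) y-middle) ⟩
  y ∷ sc-run (suc f) (x ∷ xs) (z ∷ s)
    ≡⟨ cong (y ∷_) (sc-run-push f x xs (z ∷ s) (has321-pop x y z s free z<ᵇy)) ⟩
  y ∷ sc-run f xs (x ∷ z ∷ s)
    ≡⟨ cong (y ∷_) (sc-run-simulates xs f y x z s (has321-pop x y z s free z<ᵇy) z<ᵇx≡y<ᵇx fuel) ⟩
  y ∷ middlesAfter y (x ∷ xs) ++ reverse (othersAfter y (x ∷ xs)) ++ z ∷ s ∎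
  where
  open ≡-Reasoning
  p<y×y<x : p < y × y < x
  p<y×y<x = rises⇒< p y x y-middle
  z<ᵇy : (z <ᵇ y) ≡ true
  z<ᵇy = trans z<y≡p<y (<⇒<ᵇ-true (proj₁ p<y×y<x))
  z<ᵇx≡y<ᵇx : (z <ᵇ x) ≡ (y <ᵇ x)
  z<ᵇx≡y<ᵇx = trans (<⇒<ᵇ-true (<-trans (<ᵇ-true⇒< z y z<ᵇy) (proj₂ p<y×y<x)))
                    (sym (<⇒<ᵇ-true (proj₂ p<y×y<x)))

SC321≗SC : ∀ π → SC321 π ≡ SC π
SC321≗SC [] = refl
SC321≗SC (a ∷ []) = refl
SC321≗SC (a ∷ b ∷ xs) = begin
  sc-run (2 * length (a ∷ b ∷ xs)) (a ∷ b ∷ xs) []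
    ≡⟨ cong (λ f → sc-run f (a ∷ b ∷ xs) []) (steps≡2*length (a ∷ b ∷ xs)) ⟨
  sc-run (suc (suc (steps xs))) xs (b ∷ a ∷ [])
    ≡⟨ sc-run-simulates xs _ a b a [] refl refl (≤-reflexive (+-comm (steps xs) 2)) ⟩
  middlesAfter a (b ∷ xs) ++ reverse (othersAfter a (b ∷ xs)) ++ a ∷ []
    ≡⟨ cong (middlesAfter a (b ∷ xs) ++_) (reverse-∷-++ a (othersAfter a (b ∷ xs)) []) ⟨
  middlesAfter a (b ∷ xs) ++ reverse (others (a ∷ b ∷ xs)) ++ []
    ≡⟨ cong (middlesAfter a (b ∷ xs) ++_) (++-identityʳ _) ⟩
  SC (a ∷ b ∷ xs) ∎
  where open ≡-Reasoning

length-middlesAfter : ∀ p l → length (middlesAfter p l) ≡ #rises (p ∷ l)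
length-middlesAfter p [] = refl
length-middlesAfter p (x ∷ l) with startsWith rises (p ∷ x ∷ l)
... | true = cong suc (length-middlesAfter x l)
... | false = length-middlesAfter x l

length-middles : ∀ l → length (middles l) ≡ #rises l
length-middles [] = refl
length-middles (a ∷ l) = length-middlesAfter a l

-- After x, the next kept entry k is y itself, unless y is a middle (so x < y) and k > y.
NextKept : ℕ → ℕ → ℕ → Set
NextKept x y k = k ≡ y ⊎ (x < y × y < k)

KeptHead : ℕ → ℕ → List ℕ → Set
KeptHead x y [] = ⊤
KeptHead x y (k ∷ _) = NextKept x y k

othersAfter-head : ∀ x y r → KeptHead x y (othersAfter x (y ∷ r))
othersAfter-head x y r with startsWith rises (x ∷ y ∷ r) in y-middle
... | false = inj₁ refl
othersAfter-head x y (z ∷ r) | true with othersAfter y (z ∷ r) | othersAfter-head y z r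
... | [] | _ = _
... | k ∷ _ | inj₁ refl = inj₂ (rises⇒< x y k y-middle)
... | k ∷ _ | inj₂ (_ , z<k) with rises⇒< x y z y-middle
...   | x<y , y<z = inj₂ (x<y , <-trans y<z z<k)

nextKept-above : ∀ {x y k} → NextKept x y k → x < k → x < y
nextKept-above (inj₁ refl) x<k = x<k
nextKept-above (inj₂ (x<y , _)) _ = x<y

nextKept-below : ∀ {x y k} → NextKept x y k → k < x → y < x
nextKept-below (inj₁ refl) k<x = k<x
nextKept-below (inj₂ (x<y , y<k)) k<x = ⊥-elim (<-asym (<-trans x<y y<k) k<x)

-- q is the last entry kept so far, p the last one read and x the next one;
-- if p was dropped as a middle then q < p < x.
LastKept : ℕ → ℕ → ℕ → Set
LastKept q p x = q ≡ p ⊎ (q < p × p < x)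

lastKept-≤ : ∀ {q p x} → LastKept q p x → q ≤ p
lastKept-≤ (inj₁ refl) = ≤-refl
lastKept-≤ (inj₂ (q<p , _)) = <⇒≤ q<p

lastKept-above : ∀ {q p x} → LastKept q p x → q < x → p < x
lastKept-above (inj₁ refl) q<x = q<x
lastKept-above (inj₂ (_ , p<x)) _ = p<x

lastKept-below : ∀ {q p x} → LastKept q p x → x < q → x < p
lastKept-below (inj₁ refl) x<q = x<q
lastKept-below (inj₂ (q<p , _)) x<q = <-trans x<q q<p

-- A monotone window of the kept entries is falling and is charged to the falling
-- window of π centred at the same entry x.
window-kept : ∀ q p x y l → LastKept q p x → rises p x y ≡ false →
              boolToℕ (startsWith monotone (q ∷ x ∷ othersAfter x (y ∷ l))) ≤ boolToℕ (falls p x y)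
window-kept q p x y l last x-kept with othersAfter x (y ∷ l) | othersAfter-head x y l
... | [] | _ = z≤n
... | k ∷ K | next with rises q x k in up | falls q x k in down
...   | false | false = z≤n
...   | true | _ with rises⇒< q x k up
...     | q<x , x<k = ⊥-elim (<⇒≱ (nextKept-above next x<k) (¬rises⇒≤ (lastKept-above last q<x) x-kept))
window-kept q p x y l last x-kept | k ∷ K | next | false | true with falls⇒> q x k down
...     | x<q , k<x =
  subst (λ b → 1 ≤ boolToℕ b) (sym (>>⇒falls (lastKept-below last x<q) (nextKept-below next k<x))) ≤-refl

#monotone-othersAfter : ∀ q p x l → LastKept q p x → count monotone (q ∷ othersAfter p (x ∷ l)) ≤ #falls (p ∷ x ∷ l)
#monotone-othersAfter q p x [] _ = z≤n
#monotone-othersAfter q p x (y ∷ l) last with rises p x y in x-middle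
... | true = ≤-trans (#monotone-othersAfter q x y l (inj₂ (q<x , x<y))) (m≤n+m _ (boolToℕ (falls p x y)))
  where
  x<y : x < y
  x<y = proj₂ (rises⇒< p x y x-middle)
  q<x : q < x
  q<x = ≤-<-trans (lastKept-≤ last) (proj₁ (rises⇒< p x y x-middle))
... | false = +-mono-≤ (window-kept q p x y l last x-middle) (#monotone-othersAfter x x y l (inj₁ refl))

#monotone-others≤#falls : ∀ l → #monotone (others l) ≤ #falls l
#monotone-others≤#falls [] = z≤n
#monotone-others≤#falls (a ∷ []) = z≤n
#monotone-others≤#falls (a ∷ x ∷ l) = #monotone-othersAfter a a x l (inj₁ refl)

length-middles+#monotone-others≤ : ∀ w → length (middles w) + #monotone (reverse (others w)) ≤ #monotone w
length-middles+#monotone-others≤ w = begin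
  length (middles w) + #monotone (reverse (others w)) ≡⟨ cong₂ _+_ (length-middles w) (#monotone-reverse (others w)) ⟩
  #rises w + #monotone (others w)                      ≤⟨ +-monoʳ-≤ (#rises w) (#monotone-others≤#falls w) ⟩
  #rises w + #falls w                                  ≡⟨ #monotone≡#rises+#falls w ⟨
  #monotone w                                          ∎
  where open ≤-Reasoning

#monotone-SC≤ : ∀ w → #monotone (SC w) ≤ #monotone w
#monotone-SC≤ w = ≤-trans (count-++-≤ monotone (middles w) (reverse (others w))) (length-middles+#monotone-others≤ w)

#monotone-SC< : ∀ w L m L′ → middles w ≡ L ++ m ∷ L′ →
                startsWith monotone (m ∷ L′ ++ reverse (others w)) ≡ false → #monotone (SC w) < #monotone w
#monotone-SC< w L m L′ split skip = begin-strict
  #monotone (SC w)                        ≡⟨ cong (λ M → #monotone (M ++ R)) split ⟩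
  #monotone ((L ++ m ∷ L′) ++ R)          ≡⟨ cong #monotone (++-assoc L (m ∷ L′) R) ⟩
  #monotone (L ++ m ∷ L′ ++ R)            ≤⟨ count-++-skip monotone L m (L′ ++ R) skip ⟩
  length L + #monotone (L′ ++ R)          ≤⟨ +-monoʳ-≤ (length L) (count-++-≤ monotone L′ R) ⟩
  length L + (length L′ + #monotone R)    <⟨ +-monoʳ-< (length L) (n<1+n _) ⟩
  length L + suc (length L′ + #monotone R) ≡⟨ +-assoc (length L) (suc (length L′)) (#monotone R) ⟨
  (length L + length (m ∷ L′)) + #monotone R ≡⟨ cong (_+ #monotone R) (length-++ L) ⟨
  length (L ++ m ∷ L′) + #monotone R      ≡⟨ cong (λ M → length M + #monotone R) split ⟨
  length (middles w) + #monotone R        ≤⟨ length-middles+#monotone-others≤ w ⟩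
  #monotone w                             ∎
  where
  open ≤-Reasoning
  R : List ℕ
  R = reverse (others w)

middlesAfter-no-rise : ∀ p l → #rises (p ∷ l) ≡ 0 → middlesAfter p l ≡ []
middlesAfter-no-rise p [] _ = refl
middlesAfter-no-rise p (x ∷ l) none with count-∷≡0 rises p (x ∷ l) none
... | x-kept , rest rewrite x-kept = middlesAfter-no-rise x l rest

othersAfter-no-rise : ∀ p l → #rises (p ∷ l) ≡ 0 → othersAfter p l ≡ l
othersAfter-no-rise p [] _ = refl
othersAfter-no-rise p (x ∷ l) none with count-∷≡0 rises p (x ∷ l) none
... | x-kept , rest rewrite x-kept = cong (x ∷_) (othersAfter-no-rise x l rest)

SC-no-rise : ∀ w → #rises w ≡ 0 → SC w ≡ reverse w
SC-no-rise [] _ = refl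
SC-no-rise (a ∷ l) none =
  cong₂ (λ M K → M ++ reverse (a ∷ K)) (middlesAfter-no-rise a l none) (othersAfter-no-rise a l none)

SC-falling-start : ∀ a b c T → falls a b c ≡ true → ∃[ P ] SC (a ∷ b ∷ c ∷ T) ≡ P ++ c ∷ b ∷ a ∷ []
SC-falling-start a b c T down = M ++ reverse K , (begin
  M ++ reverse (others (a ∷ b ∷ c ∷ T))  ≡⟨ cong (λ O → M ++ reverse O) all-kept ⟩
  M ++ reverse ((a ∷ b ∷ c ∷ []) ++ K)    ≡⟨ cong (M ++_) (reverse-++ (a ∷ b ∷ c ∷ []) K) ⟩
  M ++ reverse K ++ c ∷ b ∷ a ∷ []        ≡⟨ ++-assoc M (reverse K) _ ⟨
  (M ++ reverse K) ++ c ∷ b ∷ a ∷ []      ∎)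
  where
  open ≡-Reasoning
  M K : List ℕ
  M = middles (a ∷ b ∷ c ∷ T)
  K = othersAfter c T
  all-kept : others (a ∷ b ∷ c ∷ T) ≡ a ∷ b ∷ c ∷ K
  all-kept rewrite descent-not-middle (c ∷ T) (proj₁ (falls⇒> a b c down))
                 | descent-not-middle T (proj₂ (falls⇒> a b c down)) = refl

first : List ℕ → ℕ
first [] = 0
first (a ∷ _) = a

rising-start⇒first< : ∀ v → startsWith rises v ≡ true → first v < first (SC v)
rising-start⇒first< (a ∷ b ∷ c ∷ T) up rewrite up = proj₁ (rises⇒< a b c up)

-- If w ends with a consecutive 123 (a, b, c), then b is the last middle and c the last
-- kept entry, preceded among the kept entries by some v < c: SC w contains the peak (b, c, v).
module RisingEnd (a b c : ℕ) (up : rises a b c ≡ true) where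

  abc : List ℕ
  abc = a ∷ b ∷ c ∷ []

  a<b : a < b
  a<b = proj₁ (rises⇒< a b c up)

  b<c : b < c
  b<c = proj₂ (rises⇒< a b c up)

  middlesAfter-end : ∀ p P → ∃[ L ] middlesAfter p (P ++ abc) ≡ L ++ b ∷ []
  middlesAfter-end p [] rewrite up with rises p a b
  ... | true = a ∷ [] , refl
  ... | false = [] , refl
  middlesAfter-end p (x ∷ P) with startsWith rises (p ∷ x ∷ P ++ abc) | middlesAfter-end x P
  ... | true | L , split = x ∷ L , cong (x ∷_) split
  ... | false | L , split = L , split

  othersAfter-end : ∀ q p P → q ≤ p → ∃[ K ] ∃[ v ] (q ∷ othersAfter p (P ++ abc) ≡ K ++ v ∷ c ∷ [] × v < c)
  othersAfter-end q p [] q≤p rewrite up with rises p a b in a-middle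
  ... | true = [] , q , refl , ≤-<-trans q≤p (<-trans (proj₁ (rises⇒< p a b a-middle)) (<-trans a<b b<c))
  ... | false = q ∷ [] , a , refl , <-trans a<b b<c
  othersAfter-end q p (x ∷ P) q≤p with startsWith rises (p ∷ x ∷ P ++ abc) in x-middle
  ... | true = othersAfter-end q x P (<⇒≤ (≤-<-trans q≤p (rising-start⇒< p x (P ++ abc) x-middle)))
  ... | false with othersAfter-end x x P ≤-refl
  ...   | K , v , split , v<c = q ∷ K , v , cong (q ∷_) split , v<c

  end-shape : ∀ P → (∃[ L ] middles (P ++ abc) ≡ L ++ b ∷ []) ×
               (∃[ K ] ∃[ v ] (others (P ++ abc) ≡ K ++ v ∷ c ∷ [] × v < c))
  end-shape [] rewrite up = ([] , refl) , ([] , a , refl , <-trans a<b b<c)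
  end-shape (y ∷ P) = middlesAfter-end y P , othersAfter-end y y P ≤-refl

  #monotone-SC<-rising-end : ∀ P → #monotone (SC (P ++ abc)) < #monotone (P ++ abc)
  #monotone-SC<-rising-end P with end-shape P
  ... | (L , mid) , (K , v , kept , v<c) =
    #monotone-SC< (P ++ abc) L b [] mid
      (trans (cong (λ R → startsWith monotone (b ∷ R)) (trans (cong reverse kept) (reverse-++ K (v ∷ c ∷ []))))
             (peak-not-monotone b<c v<c))

steady⇒starts-monotone : ∀ w e E → middles w ≡ e ∷ E → #monotone (SC w) ≡ #monotone w →
                         startsWith monotone (SC w) ≡ true
steady⇒starts-monotone w e E split steady with startsWith monotone (e ∷ E ++ reverse (others w)) in starts
... | true = trans (cong (λ M → startsWith monotone (M ++ reverse (others w))) split) starts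
... | false = ⊥-elim (<-irrefl steady (#monotone-SC< w [] e E split starts))

-- A falling start of v puts a consecutive 123 at the end of SC v.
starts-monotone⇒starts-rising : ∀ v → startsWith monotone v ≡ true → #monotone (SC (SC v)) ≡ #monotone (SC v) →
                                startsWith rises v ≡ true
starts-monotone⇒starts-rising (a ∷ b ∷ c ∷ T) mono steady with rises-or-falls a b c mono
... | inj₁ up = up
... | inj₂ down with SC-falling-start a b c T down
...   | P , ends-rising = ⊥-elim (<-irrefl steady (subst (λ u → #monotone (SC u) < #monotone u) (sym ends-rising)
                    (RisingEnd.#monotone-SC<-rising-end c b a (trans (rises˘≡falls a b c) down) P)))

middles-nonempty : ∀ w → 0 < #rises w → ∃[ e ] ∃[ E ] middles w ≡ e ∷ E
middles-nonempty w some with middles w in split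
... | e ∷ E = e , E , refl
... | [] = ⊥-elim (<-irrefl (trans (cong length (sym split)) (length-middles w)) some)

Steady : List ℕ → Set
Steady w = ∀ k → #monotone (SC (iter SC k w)) ≡ #monotone (iter SC k w)

steady-iter : ∀ w → Steady w → ∀ k → Steady (iter SC k w)
steady-iter w steady k j = subst (λ y → #monotone (SC y) ≡ #monotone y) (iter-+ SC j k w) (steady (j + k))

steady⇒SC-starts-rising : ∀ w → 0 < #rises w → Steady w → startsWith rises (SC w) ≡ true
steady⇒SC-starts-rising w some steady with middles-nonempty w some
... | e , E , split = starts-monotone⇒starts-rising (SC w) (steady⇒starts-monotone w e E split (steady 0)) (steady 2)

steady⇒SC-has-rise : ∀ w → 0 < #monotone w → Steady w → 0 < #rises (SC w)
steady⇒SC-has-rise w pos steady with #rises w in r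
... | suc _ = startsWith⇒0<count rises (SC w) (steady⇒SC-starts-rising w (subst (0 <_) (sym r) (s≤s z≤n)) steady)
... | zero = begin-strict
  0                      <⟨ pos ⟩
  #monotone w            ≡⟨ #monotone≡#rises+#falls w ⟩
  #rises w + #falls w    ≡⟨ cong (_+ #falls w) r ⟩
  #falls w               ≡⟨ #rises-reverse w ⟨
  #rises (reverse w)     ≡⟨ cong #rises (SC-no-rise w r) ⟨
  #rises (SC w)          ∎
  where open ≤-Reasoning

steady⇒first-ascending : ∀ π → Steady π → 0 < #monotone π →
                         ∀ k → first (SC (SC (iter SC k π))) < first (SC (SC (SC (iter SC k π))))
steady⇒first-ascending π steady pos k = rising-start⇒first< (SC (SC w))
  (steady⇒SC-starts-rising (SC w) (steady⇒SC-has-rise w pos-w steady-w) (steady-iter π steady (suc k)))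
  where
  w : List ℕ
  w = iter SC k π
  steady-w : Steady w
  steady-w = steady-iter π steady k
  pos-w : 0 < #monotone w
  pos-w = subst (0 <_) (sym (steady⇒constant SC #monotone steady k)) pos

periodic⇒#monotone≡0 : ∀ π → Periodic SC321 π → #monotone π ≡ 0
periodic⇒#monotone≡0 π (suc t , _ , cycle) = n≤0⇒n≡0 (≮⇒≥ λ positive →
  periodic⇒¬ascending SC (first ∘ SC ∘ SC) t cycle-SC
    (steady⇒first-ascending π (periodic⇒steady SC #monotone #monotone-SC≤ t cycle-SC) positive))
  where
  cycle-SC : iter SC (suc t) π ≡ π
  cycle-SC = trans (sym (iter-cong SC321≗SC (suc t) π)) cycle

periodic⇒avoids : ∀ π → Periodic SC321 π → Avoids123 π × Avoids321 π
periodic⇒avoids π periodic =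
  Equivalence.to (#rises≡0⇔Avoids123 π) (m+n≡0⇒m≡0 (#rises π) none) ,
  Equivalence.to (#falls≡0⇔Avoids321 π) (m+n≡0⇒n≡0 (#rises π) none)
  where
  none : #rises π + #falls π ≡ 0
  none = trans (sym (#monotone≡#rises+#falls π)) (periodic⇒#monotone≡0 π periodic)

avoids123⇒SC321≡reverse : ∀ π → Avoids123 π → SC321 π ≡ reverse π
avoids123⇒SC321≡reverse π avoid =
  trans (SC321≗SC π) (SC-no-rise π (Equivalence.from (#rises≡0⇔Avoids123 π) avoid))

avoids⇒SC321²≡id : ∀ π → Avoids123 π × Avoids321 π → iter SC321 2 π ≡ π
avoids⇒SC321²≡id π (avoid123 , avoid321) = begin
  SC321 (SC321 π)        ≡⟨ cong SC321 (avoids123⇒SC321≡reverse π avoid123) ⟩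
  SC321 (reverse π)      ≡⟨ avoids123⇒SC321≡reverse (reverse π) reverse-avoids123 ⟩
  reverse (reverse π)    ≡⟨ reverse-involutive π ⟩
  π                      ∎
  where
  open ≡-Reasoning
  reverse-avoids123 : Avoids123 (reverse π)
  reverse-avoids123 = Equivalence.to (#rises≡0⇔Avoids123 (reverse π))
    (trans (#rises-reverse π) (Equivalence.from (#falls≡0⇔Avoids321 π) avoid321))

unique⇒¬palindrome : ∀ (a : ℕ) xs → Unique (a ∷ xs) → xs ≢ [] → reverse (a ∷ xs) ≢ a ∷ xs
unique⇒¬palindrome a xs (a∉xs ∷ _) nonempty palindrome with initLast xs
... | [] = nonempty refl
... | ys ∷ʳ′ z =
  proj₂ (∷ʳ⁻ a∉xs) (sym (∷-injectiveˡ (trans (sym (reverse-++ (a ∷ ys) (z ∷ []))) palindrome)))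

permutation-unique : ∀ n π → S n π → Unique π
permutation-unique n π σ =
  Unique-resp-↭ (↭⇒↭ₛ (↭-sym σ)) (applyUpTo⁺₁ suc n (λ i<j _ → <⇒≢ i<j ∘ suc-injective))

permutation-length : ∀ n π → S n π → length π ≡ n
permutation-length n π σ = trans (↭-length σ) (length-applyUpTo suc n)

SC321-no-fixed-avoider : ∀ n π → 2 ≤ n → S n π → Avoids123 π → SC321 π ≢ π
SC321-no-fixed-avoider n [] 2≤n σ _ _ = <⇒≱ 2≤n (m≤n⇒m≤1+n (≤-reflexive (sym (permutation-length n [] σ))))
SC321-no-fixed-avoider n (a ∷ []) 2≤n σ _ _ = <⇒≱ 2≤n (≤-reflexive (sym (permutation-length n (a ∷ []) σ)))
SC321-no-fixed-avoider n (a ∷ b ∷ l) _ σ avoid fixed =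
  unique⇒¬palindrome a (b ∷ l) (permutation-unique n (a ∷ b ∷ l) σ) (λ ())
    (trans (sym (avoids123⇒SC321≡reverse (a ∷ b ∷ l) avoid)) fixed)

proposition3p7 : (n : ℕ) → 1 ≤ n →
    ((π : List ℕ) → S n π → (Periodic SC321 π ⇔ (Avoids123 π × Avoids321 π)))
    × (2 ≤ n → (π : List ℕ) → S n π → Periodic SC321 π → HasPeriod SC321 π 2)
proposition3p7 n _ = (λ π _ → mk⇔ (periodic⇒avoids π) avoids⇒periodic) , period-two
  where
  avoids⇒periodic : ∀ {π} → Avoids123 π × Avoids321 π → Periodic SC321 π
  avoids⇒periodic {π} avoid = 2 , s≤s z≤n , avoids⇒SC321²≡id π avoid
  period-two : 2 ≤ n → (π : List ℕ) → S n π → Periodic SC321 π → HasPeriod SC321 π 2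
  period-two 2≤n π σ periodic = s≤s z≤n , avoids⇒SC321²≡id π avoid , λ
    { (suc zero) _ _ → SC321-no-fixed-avoider n π 2≤n σ (proj₁ avoid)
    ; (suc (suc _)) _ (s≤s (s≤s ())) }
    where
    avoid : Avoids123 π × Avoids321 π
    avoid = periodic⇒avoids π periodic
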